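{- Let the alphabet be $\mathcal{A}=\{0,1,\dots,q-1\}$ with $G=\mathbb{Z}_q$ acting by $g\cdot i=g+i \pmod q$ letterwise on words. Let $p$ be a pattern of length $\ell\ge 1$ and $n\ge0$. Then: (1) if $n=0$, $\mathcal{A}(0,\{p\})=1$ and $\mathcal{T}_p(0,\{p\})=0$; (2) if $n=1$, $\mathcal{A}(1,\{p\})=q$ when $\ell\ge2$ and $0$ otherwise, and $\mathcal{T}_p(1,\{p\})=0$ when $\ell\ge2$ and $q$ otherwise; (3) if $n\ge2$ (and $\ell\ge 2$), $\mathcal{A}(n,\{p\})=q\,A(n-1,\{S(p)\})$ and $\mathcal{T}_p(n,\{p\})=q\,T_{S(p)}(n-1,\{S(p)\})$.
   Context: A pattern is a $G$-orbit of words (represented by its lexicographically least word). $\mathcal{A}(n,\{p\})$ is the number of words of length $n$ over $\mathcal{A}$ containing no factor in the orbit $p$; $\mathcal{T}_p(n,\{p\})$ is the number of words of length $n$ whose only factor in the orbit $p$ occurs at the very end. For a word $w$, $A(n,\{w\})$ is the number of words of length $n$ not containing $w$ as a factor, and $T_w(n,\{w\})$ the number of words of length $n$ whose only occurrence of $w$ is at the very end. For a pattern (or word) $p=p(1)\cdots p(\ell)$ with $\ell\ge2$, the adjacency signature $S(p)$ is the word $s(1)\cdots s(\ell-1)$ over $\mathcal{A}$ with $s(i)\equiv p(i+1)-p(i)\pmod q$; it does not depend on the representative of the pattern. -}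

module Defs where

open import Data.Nat using (ℕ; zero; suc; _+_; _∸_; NonZero)
open import Data.Nat.DivMod using (_mod_)
open import Data.Fin using (Fin; toℕ)
open import Data.Fin.Properties using (any?) renaming (_≟_ to _≟ᶠ_)
open import Data.List using (List; []; _∷_; map; concatMap; length; filter; allFin)
open import Data.Product using (∃; _×_)
open import Relation.Nullary using (Dec; ¬_; _×-dec_; ¬?)
open import Relation.Binary.PropositionalEquality using (_≡_)
open import Data.List.Relation.Binary.Infix.Heterogeneous using (Infix)
open import Data.List.Relation.Binary.Infix.Heterogeneous.Properties using (infix?)
open import Data.List.Relation.Binary.Suffix.Heterogeneous using (Suffix)
open import Data.List.Relation.Binary.Suffix.Heterogeneous.Properties using (suffix?)
open import Relation.Unary using (Pred; Decidable)
open import Agda.Primitive using (lzero)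

Word : ℕ → Set
Word q = List (Fin q)

allWords : (q n : ℕ) → List (Word q)
allWords q zero    = [] ∷ []
allWords q (suc n) = concatMap (λ w → map (λ a → a ∷ w) (allFin q)) (allWords q n)

count : ∀ {q} {P : Pred (Word q) lzero} → Decidable P → ℕ → ℕ
count {q} P? n = length (filter P? (allWords q n))

act : ∀ {q} .{{_ : NonZero q}} → Fin q → Word q → Word q
act {q} g w = map (λ i → (toℕ g + toℕ i) mod q) w

-- adjacency signature S(p): s(i) ≡ p(i+1) - p(i) (mod q)
sig : ∀ {q} .{{_ : NonZero q}} → Word q → Word q
sig []              = []
sig (a ∷ [])        = []
sig {q} (a ∷ b ∷ w) = ((toℕ b + (q ∸ toℕ a)) mod q) ∷ sig (b ∷ w)

IsFactor : ∀ {q} → Word q → Word q → Set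
IsFactor w u = Infix _≡_ w u

IsSuffix : ∀ {q} → Word q → Word q → Set
IsSuffix w u = Suffix _≡_ w u

dropLast : ∀ {A : Set} → List A → List A
dropLast []           = []
dropLast (a ∷ [])     = []
dropLast (a ∷ b ∷ u)  = a ∷ dropLast (b ∷ u)

HasOrbitFactor : ∀ {q} .{{_ : NonZero q}} → Word q → Word q → Set
HasOrbitFactor p u = ∃ λ g → IsFactor (act g p) u

-- u's only factor in the orbit G·p occurs at the very end:
-- u ends with an element of the orbit, and u minus its last letter has no
-- factor in the orbit.
EndsOnlyOrbit : ∀ {q} .{{_ : NonZero q}} → Word q → Word q → Set
EndsOnlyOrbit p u = (∃ λ g → IsSuffix (act g p) u) × ¬ HasOrbitFactor p (dropLast u)

EndsOnly : ∀ {q} → Word q → Word q → Set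
EndsOnly w u = IsSuffix w u × ¬ IsFactor w (dropLast u)

hasOrbitFactor? : ∀ {q} .{{_ : NonZero q}} (p : Word q) → Decidable (HasOrbitFactor p)
hasOrbitFactor? p u = any? (λ g → infix? _≟ᶠ_ (act g p) u)

endsOnlyOrbit? : ∀ {q} .{{_ : NonZero q}} (p : Word q) → Decidable (EndsOnlyOrbit p)
endsOnlyOrbit? p u = any? (λ g → suffix? _≟ᶠ_ (act g p) u) ×-dec ¬? (hasOrbitFactor? p (dropLast u))

endsOnly? : ∀ {q} (w : Word q) → Decidable (EndsOnly w)
endsOnly? w u = suffix? _≟ᶠ_ w u ×-dec ¬? (infix? _≟ᶠ_ w (dropLast u))

𝒜 : ∀ {q} .{{_ : NonZero q}} → ℕ → Word q → ℕ
𝒜 n p = count (λ u → ¬? (hasOrbitFactor? p u)) n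

𝒯 : ∀ {q} .{{_ : NonZero q}} → ℕ → Word q → ℕ
𝒯 n p = count (endsOnlyOrbit? p) n

A : ∀ {q} → ℕ → Word q → ℕ
A n w = count (λ u → ¬? (infix? _≟ᶠ_ w u)) n

T : ∀ {q} → ℕ → Word q → ℕ
T n w = count (endsOnly? w) n

-- The signature map S forgets exactly the translation: S(g·u) = S(u), and a word is
-- recovered from its first letter and its signature.  Hence for |p| ≥ 2 the word u
-- contains a translate of p as a factor (resp. as a suffix) iff S(u) contains S(p)
-- as a factor (resp. as a suffix), and S commutes with deleting the last letter.
-- Since S is q-to-one from words of length n onto words of length n - 1 (for fixed
-- second letter, u(1) ↦ u(2) - u(1) permutes the alphabet), each count for p is q
-- times the corresponding count for S(p).
module Submission where

open import Level using (0ℓ)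
open import Data.Fin using (Fin; toℕ; zero; suc)
open import Data.Fin.Permutation using (permutation)
open import Data.Fin.Properties using (toℕ-fromℕ<; toℕ-injective; toℕ<n)
open import Data.List using (List; []; _∷_; [_]; map; concatMap; length; filter; allFin; tabulate; _++_)
open import Data.List.Properties using (map-++; map-∘; map-cong; map-tabulate; length-map)
open import Data.List.Relation.Binary.Infix.Heterogeneous using (here; there)
open import Data.List.Relation.Binary.Infix.Heterogeneous.Properties using (fromSuffix; length-mono)
import Data.List.Relation.Binary.Pointwise as Pointwise
open Pointwise using (Pointwise-≡⇒≡; ≡⇒Pointwise-≡)
open import Data.List.Relation.Binary.Prefix.Heterogeneous using (Prefix; []; _∷_)
open import Data.List.Relation.Binary.Suffix.Heterogeneous using (here; there)
open import Data.Nat using (ℕ; zero; suc; _+_; _*_; _∸_; _≤_; _<_; NonZero; s≤s; z≤n)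
open import Data.Nat.DivMod using (_mod_; _%_; m%n%n≡m%n; [m+n]%n≡m%n; m<n⇒m%n≡m; %-distribˡ-+; m%n<n)
open import Data.Nat.ListAction using (sum)
open import Data.Nat.ListAction.Properties using (sum-++)
open import Data.Nat.Properties
  using (+-assoc; +-comm; +-identityʳ; *-identityʳ; *-zeroʳ; m+[n∸m]≡n; <⇒≤; <⇒≱
        ; +-0-commutativeMonoid)
open import Algebra.Properties.CommutativeMonoid.Sum +-0-commutativeMonoid
  using (sum-permute) renaming (sum to ∑)
open import Data.Nat.Tactic.RingSolver using (solve-∀)
open import Data.Product using (_×_; _,_; ∃)
open import Data.Product.Function.NonDependent.Propositional using (_×-⇔_)
open import Function using (_∘_; _⇔_; mk⇔; Equivalence)
open import Function.Related.TypeIsomorphisms using (¬-cong-⇔)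
open import Relation.Binary using (Setoid)
import Relation.Binary.Construct.On as On
open import Relation.Binary.PropositionalEquality
  using (_≡_; refl; sym; trans; cong; cong₂; subst; subst₂; setoid; module ≡-Reasoning)
import Relation.Binary.Reasoning.Setoid as SetoidReasoning
open import Relation.Nullary using (Dec; yes; no; ¬_; ¬?; contradiction)
open import Relation.Unary using (Pred; Decidable)

open import Defs

open Equivalence using (to; from)

-- Arithmetic in ℤ_q

module _ {q : ℕ} .{{_ : NonZero q}} where

  private
    ≈-setoid : Setoid 0ℓ 0ℓ
    ≈-setoid = On.setoid (setoid ℕ) (_% q)

    open Setoid ≈-setoid using (_≈_)
    module ≈-Reasoning = SetoidReasoning ≈-setoid

    +-cong-≈ : ∀ {m m′ n n′} → m ≈ m′ → n ≈ n′ → m + n ≈ m′ + n′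
    +-cong-≈ {m} {m′} {n} {n′} m≈m′ n≈n′ = begin
      (m + n) % q                ≡⟨ %-distribˡ-+ m n q ⟩
      (m % q + n % q) % q        ≡⟨ cong₂ (λ x y → (x + y) % q) m≈m′ n≈n′ ⟩
      (m′ % q + n′ % q) % q      ≡⟨ %-distribˡ-+ m′ n′ q ⟨
      (m′ + n′) % q              ∎
      where open ≡-Reasoning

    +q-≈ : ∀ m → m + q ≈ m
    +q-≈ m = [m+n]%n≡m%n m q

    toℕ-mod-≈ : ∀ m → toℕ (m mod q) ≈ m
    toℕ-mod-≈ m = trans (cong (_% q) (toℕ-fromℕ< (m%n<n m q))) (m%n%n≡m%n m q)

    ≈⇒≡ : ∀ {i j : Fin q} → toℕ i ≈ toℕ j → i ≡ j
    ≈⇒≡ {i} {j} i≈j =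
      toℕ-injective (trans (sym (m<n⇒m%n≡m (toℕ<n i))) (trans i≈j (m<n⇒m%n≡m (toℕ<n j))))

  infixl 6 _⊕_ _⊖_

  -- act and sig in Defs unfold to these two operations.
  _⊕_ : Fin q → Fin q → Fin q
  g ⊕ i = (toℕ g + toℕ i) mod q

  _⊖_ : Fin q → Fin q → Fin q
  b ⊖ a = (toℕ b + (q ∸ toℕ a)) mod q

  private
    toℕ-⊕ : ∀ g i → toℕ (g ⊕ i) ≈ toℕ g + toℕ i
    toℕ-⊕ g i = toℕ-mod-≈ (toℕ g + toℕ i)

    a+[q∸a]≡q : ∀ (a : Fin q) → toℕ a + (q ∸ toℕ a) ≡ q
    a+[q∸a]≡q a = m+[n∸m]≡n (<⇒≤ (toℕ<n a))

    ⊖-unique : ∀ {a b x} → toℕ x + toℕ a ≈ toℕ b → b ⊖ a ≡ x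
    ⊖-unique {a} {b} {x} x+a≈b = ≈⇒≡ (begin
      toℕ (b ⊖ a)                    ≈⟨ toℕ-mod-≈ _ ⟩
      toℕ b + (q ∸ toℕ a)            ≈⟨ +-cong-≈ x+a≈b refl ⟨
      toℕ x + toℕ a + (q ∸ toℕ a)    ≡⟨ +-assoc (toℕ x) _ _ ⟩
      toℕ x + (toℕ a + (q ∸ toℕ a))  ≡⟨ cong (toℕ x +_) (a+[q∸a]≡q a) ⟩
      toℕ x + q                      ≈⟨ +q-≈ (toℕ x) ⟩
      toℕ x                          ∎)
      where open ≈-Reasoning

  ⊖-⊕ : ∀ b a → b ⊖ a ⊕ a ≡ b
  ⊖-⊕ b a = ≈⇒≡ (begin
    toℕ (b ⊖ a ⊕ a)                ≈⟨ toℕ-⊕ (b ⊖ a) a ⟩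
    toℕ (b ⊖ a) + toℕ a            ≈⟨ +-cong-≈ (toℕ-mod-≈ _) refl ⟩
    toℕ b + (q ∸ toℕ a) + toℕ a    ≡⟨ +-assoc (toℕ b) _ _ ⟩
    toℕ b + ((q ∸ toℕ a) + toℕ a)  ≡⟨ cong (toℕ b +_) (trans (+-comm _ (toℕ a)) (a+[q∸a]≡q a)) ⟩
    toℕ b + q                      ≈⟨ +q-≈ (toℕ b) ⟩
    toℕ b                          ∎)
    where open ≈-Reasoning

  ⊖-involutive : ∀ b a → b ⊖ (b ⊖ a) ≡ a
  ⊖-involutive b a = ⊖-unique (begin
    toℕ a + toℕ (b ⊖ a)    ≡⟨ +-comm (toℕ a) _ ⟩
    toℕ (b ⊖ a) + toℕ a    ≈⟨ toℕ-⊕ (b ⊖ a) a ⟨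
    toℕ (b ⊖ a ⊕ a)        ≡⟨ cong toℕ (⊖-⊕ b a) ⟩
    toℕ b                  ∎)
    where open ≈-Reasoning

  ⊖-translate : ∀ g b a → (g ⊕ b) ⊖ (g ⊕ a) ≡ b ⊖ a
  ⊖-translate g b a = ⊖-unique (begin
    toℕ (b ⊖ a) + toℕ (g ⊕ a)        ≈⟨ +-cong-≈ refl (toℕ-⊕ g a) ⟩
    toℕ (b ⊖ a) + (toℕ g + toℕ a)    ≡⟨ shuffle (toℕ (b ⊖ a)) (toℕ g) (toℕ a) ⟩
    toℕ g + (toℕ (b ⊖ a) + toℕ a)    ≈⟨ +-cong-≈ refl (toℕ-⊕ (b ⊖ a) a) ⟨
    toℕ g + toℕ (b ⊖ a ⊕ a)          ≡⟨ cong (λ c → toℕ g + toℕ c) (⊖-⊕ b a) ⟩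
    toℕ g + toℕ b                    ≈⟨ toℕ-⊕ g b ⟨
    toℕ (g ⊕ b)                      ∎)
    where
      open ≈-Reasoning
      shuffle : ∀ x y z → x + (y + z) ≡ y + (x + z)
      shuffle = solve-∀

  ⊕-left-comm : ∀ g s x → g ⊕ (s ⊕ x) ≡ s ⊕ (g ⊕ x)
  ⊕-left-comm g s x = ≈⇒≡ (begin
    toℕ (g ⊕ (s ⊕ x))          ≈⟨ toℕ-⊕ g (s ⊕ x) ⟩
    toℕ g + toℕ (s ⊕ x)        ≈⟨ +-cong-≈ refl (toℕ-⊕ s x) ⟩
    toℕ g + (toℕ s + toℕ x)    ≡⟨ shuffle (toℕ g) (toℕ s) (toℕ x) ⟩
    toℕ s + (toℕ g + toℕ x)    ≈⟨ +-cong-≈ refl (toℕ-⊕ g x) ⟨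
    toℕ s + toℕ (g ⊕ x)        ≈⟨ toℕ-⊕ s (g ⊕ x) ⟨
    toℕ (s ⊕ (g ⊕ x))          ∎)
    where
      open ≈-Reasoning
      shuffle : ∀ x y z → x + (y + z) ≡ y + (x + z)
      shuffle = solve-∀

-- Signatures of words

module _ {q : ℕ} .{{_ : NonZero q}} where

  sig-act : ∀ g (w : Word q) → sig (act g w) ≡ sig w
  sig-act g []          = refl
  sig-act g (a ∷ [])    = refl
  sig-act g (a ∷ b ∷ w) = cong₂ _∷_ (⊖-translate g b a) (sig-act g (b ∷ w))

  sig-dropLast : ∀ (u : Word q) → sig (dropLast u) ≡ dropLast (sig u)
  sig-dropLast []              = refl
  sig-dropLast (a ∷ [])        = refl
  sig-dropLast (a ∷ b ∷ [])    = refl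
  sig-dropLast (a ∷ b ∷ c ∷ u) = cong (b ⊖ a ∷_) (sig-dropLast (b ∷ c ∷ u))

  Prefix-sig : ∀ {v u : Word q} → Prefix _≡_ v u → Prefix _≡_ (sig v) (sig u)
  Prefix-sig []                                          = []
  Prefix-sig {_ ∷ []}    (_ ∷ _)                         = []
  Prefix-sig {a ∷ b ∷ v} {.a ∷ .b ∷ u} (refl ∷ refl ∷ p) = refl ∷ Prefix-sig (refl ∷ p)

  Infix-sig : ∀ {v u : Word q} → IsFactor v u → IsFactor (sig v) (sig u)
  Infix-sig                 (here p)          = here (Prefix-sig p)
  Infix-sig {u = _ ∷ []}    (there (here [])) = here []
  Infix-sig {u = _ ∷ _ ∷ _} (there i)         = there (Infix-sig i)

  Suffix-sig : ∀ {v u : Word q} → IsSuffix v u → IsSuffix (sig v) (sig u)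
  Suffix-sig                 (here v≋u)                   = here (≡⇒Pointwise-≡ (cong sig (Pointwise-≡⇒≡ v≋u)))
  Suffix-sig {u = _ ∷ []}    (there (here Pointwise.[]))  = here Pointwise.[]
  Suffix-sig {u = _ ∷ _ ∷ _} (there s)                    = there (Suffix-sig s)

  integrate : Fin q → Word q → Word q
  integrate x []      = x ∷ []
  integrate x (s ∷ t) = x ∷ integrate (s ⊕ x) t

  integrate-sig : ∀ x (u : Word q) → integrate x (sig (x ∷ u)) ≡ x ∷ u
  integrate-sig x []      = refl
  integrate-sig x (y ∷ u) = cong (x ∷_) (trans (cong (λ z → integrate z (sig (y ∷ u))) (⊖-⊕ y x))
                                               (integrate-sig y u))

  act-integrate : ∀ g x (s : Word q) → act g (integrate x s) ≡ integrate (g ⊕ x) s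
  act-integrate g x []      = refl
  act-integrate g x (s ∷ t) = cong (g ⊕ x ∷_) (trans (act-integrate g (s ⊕ x) t)
                                                     (cong (λ z → integrate z t) (⊕-left-comm g s x)))

  integrate-Prefix : ∀ x {s t : Word q} → Prefix _≡_ s t → Prefix _≡_ (integrate x s) (integrate x t)
  integrate-Prefix x {t = []}    []       = refl ∷ []
  integrate-Prefix x {t = _ ∷ _} []       = refl ∷ []
  integrate-Prefix x (refl ∷ p)           = refl ∷ integrate-Prefix _ p

  act-⊖-integrate : ∀ x a (p : Word q) → act (x ⊖ a) (a ∷ p) ≡ integrate x (sig (a ∷ p))
  act-⊖-integrate x a p = begin
    act (x ⊖ a) (a ∷ p)                         ≡⟨ cong (act (x ⊖ a)) (integrate-sig a p) ⟨
    act (x ⊖ a) (integrate a (sig (a ∷ p)))     ≡⟨ act-integrate (x ⊖ a) a (sig (a ∷ p)) ⟩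
    integrate (x ⊖ a ⊕ a) (sig (a ∷ p))         ≡⟨ cong (λ z → integrate z (sig (a ∷ p))) (⊖-⊕ x a) ⟩
    integrate x (sig (a ∷ p))                   ∎
    where open ≡-Reasoning

  Prefix-unsig : ∀ a x {p u : Word q} → Prefix _≡_ (sig (a ∷ p)) (sig (x ∷ u)) →
                 Prefix _≡_ (act (x ⊖ a) (a ∷ p)) (x ∷ u)
  Prefix-unsig a x {p} {u} pre =
    subst₂ (Prefix _≡_) (sym (act-⊖-integrate x a p)) (integrate-sig x u) (integrate-Prefix x pre)

  ≡-unsig : ∀ a x {p u : Word q} → sig (a ∷ p) ≡ sig (x ∷ u) → act (x ⊖ a) (a ∷ p) ≡ x ∷ u
  ≡-unsig a x {p} {u} eq =
    trans (act-⊖-integrate x a p) (trans (cong (integrate x) eq) (integrate-sig x u))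

  module _ (a b : Fin q) (p : Word q) where

    Infix-unsig : ∀ u → IsFactor (sig (a ∷ b ∷ p)) (sig u) → HasOrbitFactor (a ∷ b ∷ p) u
    Infix-unsig []          (here ())
    Infix-unsig (_ ∷ [])    (here ())
    Infix-unsig (x ∷ y ∷ u) (here pre) = x ⊖ a , here (Prefix-unsig a x pre)
    Infix-unsig (x ∷ y ∷ u) (there i)  with Infix-unsig (y ∷ u) i
    ... | g , i′ = g , there i′

    Suffix-unsig : ∀ u → IsSuffix (sig (a ∷ b ∷ p)) (sig u) → ∃ λ g → IsSuffix (act g (a ∷ b ∷ p)) u
    Suffix-unsig []          (here ())
    Suffix-unsig (_ ∷ [])    (here ())
    Suffix-unsig (x ∷ y ∷ u) (here eq) = x ⊖ a , here (≡⇒Pointwise-≡ (≡-unsig a x (Pointwise-≡⇒≡ eq)))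
    Suffix-unsig (x ∷ y ∷ u) (there s) with Suffix-unsig (y ∷ u) s
    ... | g , s′ = g , there s′

    hasOrbitFactor⇔factor-sig : ∀ u → HasOrbitFactor (a ∷ b ∷ p) u ⇔ IsFactor (sig (a ∷ b ∷ p)) (sig u)
    hasOrbitFactor⇔factor-sig u = mk⇔
      (λ { (g , i) → subst (λ s → IsFactor s (sig u)) (sig-act g (a ∷ b ∷ p)) (Infix-sig i) })
      (Infix-unsig u)

    endsOnlyOrbit⇔endsOnly-sig : ∀ u → EndsOnlyOrbit (a ∷ b ∷ p) u ⇔ EndsOnly (sig (a ∷ b ∷ p)) (sig u)
    endsOnlyOrbit⇔endsOnly-sig u = suffix⇔ ×-⇔ ¬-cong-⇔ factor⇔
      where
        suffix⇔ : (∃ λ g → IsSuffix (act g (a ∷ b ∷ p)) u) ⇔ IsSuffix (sig (a ∷ b ∷ p)) (sig u)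
        suffix⇔ = mk⇔
          (λ { (g , s) → subst (λ w → IsSuffix w (sig u)) (sig-act g (a ∷ b ∷ p)) (Suffix-sig s) })
          (Suffix-unsig u)
        factor⇔ : HasOrbitFactor (a ∷ b ∷ p) (dropLast u) ⇔ IsFactor (sig (a ∷ b ∷ p)) (dropLast (sig u))
        factor⇔ = subst (λ w → HasOrbitFactor (a ∷ b ∷ p) (dropLast u) ⇔ IsFactor (sig (a ∷ b ∷ p)) w)
                        (sig-dropLast u) (hasOrbitFactor⇔factor-sig (dropLast u))

-- Counting

indicator : ∀ {P : Set} → Dec P → ℕ
indicator (yes _) = 1
indicator (no _)  = 0

indicator-yes : ∀ {P : Set} (P? : Dec P) → P → indicator P? ≡ 1
indicator-yes (yes _) _  = refl
indicator-yes (no ¬p) p  = contradiction p ¬p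

indicator-no : ∀ {P : Set} (P? : Dec P) → ¬ P → indicator P? ≡ 0
indicator-no (yes p) ¬p = contradiction p ¬p
indicator-no (no _)  _  = refl

indicator-cong : ∀ {P Q : Set} (P? : Dec P) (Q? : Dec Q) → P ⇔ Q → indicator P? ≡ indicator Q?
indicator-cong (yes p) Q? P⇔Q = sym (indicator-yes Q? (to P⇔Q p))
indicator-cong (no ¬p) Q? P⇔Q = sym (indicator-no Q? (¬p ∘ from P⇔Q))

length-filter : ∀ {A : Set} {P : Pred A 0ℓ} (P? : Decidable P) xs →
                length (filter P? xs) ≡ sum (map (indicator ∘ P?) xs)
length-filter P? []       = refl
length-filter P? (x ∷ xs) with P? x
... | yes _ = cong suc (length-filter P? xs)
... | no _  = length-filter P? xs

sum-map-concatMap : ∀ {A B : Set} (f : B → ℕ) (g : A → List B) xs →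
                    sum (map f (concatMap g xs)) ≡ sum (map (sum ∘ map f ∘ g) xs)
sum-map-concatMap f g []       = refl
sum-map-concatMap f g (x ∷ xs) = begin
  sum (map f (g x ++ concatMap g xs))                 ≡⟨ cong sum (map-++ f (g x) _) ⟩
  sum (map f (g x) ++ map f (concatMap g xs))         ≡⟨ sum-++ (map f (g x)) _ ⟩
  sum (map f (g x)) + sum (map f (concatMap g xs))    ≡⟨ cong (sum (map f (g x)) +_) (sum-map-concatMap f g xs) ⟩
  sum (map f (g x)) + sum (map (sum ∘ map f ∘ g) xs)  ∎
  where open ≡-Reasoning

sum-tabulate : ∀ n (h : Fin n → ℕ) → sum (tabulate h) ≡ ∑ h
sum-tabulate zero    h = refl
sum-tabulate (suc n) h = cong (h zero +_) (sum-tabulate n (h ∘ suc))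

sum-map-allFin : ∀ n (h : Fin n → ℕ) → sum (map h (allFin n)) ≡ ∑ h
sum-map-allFin n h = trans (cong sum (map-tabulate (λ i → i) h)) (sum-tabulate n h)

∑-const : ∀ n c → ∑ (λ (_ : Fin n) → c) ≡ n * c
∑-const zero    c = refl
∑-const (suc n) c = cong (c +_) (∑-const n c)

∑-cong : ∀ {n} {f g : Fin n → ℕ} → (∀ i → f i ≡ g i) → ∑ f ≡ ∑ g
∑-cong {zero}  f≗g = refl
∑-cong {suc n} f≗g = cong₂ _+_ (f≗g zero) (∑-cong (f≗g ∘ suc))

module _ {q : ℕ} .{{_ : NonZero q}} where

  ∑-⊖ : ∀ b (h : Fin q → ℕ) → ∑ (λ a → h (b ⊖ a)) ≡ ∑ h
  ∑-⊖ b h = sym (sum-permute h (permutation (b ⊖_) (b ⊖_) (⊖-involutive b) (⊖-involutive b)))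

  sum-allWords-suc : ∀ m (F : Word q → ℕ) →
    sum (map F (allWords q (suc m))) ≡ sum (map (λ w → ∑ λ a → F (a ∷ w)) (allWords q m))
  sum-allWords-suc m F = trans (sum-map-concatMap F _ (allWords q m)) (cong sum (map-cong fibre (allWords q m)))
    where
      fibre : ∀ w → sum (map F (map (_∷ w) (allFin q))) ≡ ∑ λ a → F (a ∷ w)
      fibre w = trans (cong sum (sym (map-∘ (allFin q)))) (sum-map-allFin q (λ a → F (a ∷ w)))

  sum-sig : ∀ m (f : Word q → ℕ) → sum (map (f ∘ sig) (allWords q (suc m))) ≡ q * sum (map f (allWords q m))
  sum-sig zero    f = begin
    sum (map (f ∘ sig) (allWords q 1))  ≡⟨ sum-allWords-suc 0 (f ∘ sig) ⟩
    ∑ (λ (_ : Fin q) → f []) + 0  ≡⟨ +-identityʳ _ ⟩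
    ∑ (λ (_ : Fin q) → f [])      ≡⟨ ∑-const q (f []) ⟩
    q * f []            ≡⟨ cong (q *_) (+-identityʳ (f [])) ⟨
    q * (f [] + 0)      ∎
    where open ≡-Reasoning
  sum-sig (suc m) f = begin
    sum (map (f ∘ sig) (allWords q (suc (suc m))))                                ≡⟨ sum-allWords-suc (suc m) _ ⟩
    sum (map (λ w → ∑ λ a → f (sig (a ∷ w))) (allWords q (suc m)))                ≡⟨ sum-allWords-suc m _ ⟩
    sum (map (λ v → ∑ λ b → ∑ λ a → f (b ⊖ a ∷ sig (b ∷ v))) (allWords q m))      ≡⟨ cong sum (map-cong reindex (allWords q m)) ⟩
    sum (map (λ v → ∑ λ b → g (sig (b ∷ v))) (allWords q m))                      ≡⟨ sum-allWords-suc m (g ∘ sig) ⟨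
    sum (map (g ∘ sig) (allWords q (suc m)))                                      ≡⟨ sum-sig m g ⟩
    q * sum (map g (allWords q m))                                                ≡⟨ cong (q *_) (sum-allWords-suc m f) ⟨
    q * sum (map f (allWords q (suc m)))                                          ∎
    where
      open ≡-Reasoning
      g : Word q → ℕ
      g s = ∑ λ c → f (c ∷ s)
      reindex : ∀ v → (∑ λ b → ∑ λ a → f (b ⊖ a ∷ sig (b ∷ v))) ≡ (∑ λ b → g (sig (b ∷ v)))
      reindex v = ∑-cong (λ b → ∑-⊖ b (λ c → f (c ∷ sig (b ∷ v))))

  count-sig : ∀ {P Q : Pred (Word q) 0ℓ} (P? : Decidable P) (Q? : Decidable Q) →
              (∀ u → P u ⇔ Q (sig u)) → ∀ m → count P? (suc m) ≡ q * count Q? m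
  count-sig P? Q? P⇔Q∘sig m = begin
    count P? (suc m)                                        ≡⟨ length-filter P? (allWords q (suc m)) ⟩
    sum (map (indicator ∘ P?) (allWords q (suc m)))         ≡⟨ cong sum (map-cong transfer (allWords q (suc m))) ⟩
    sum (map ((indicator ∘ Q?) ∘ sig) (allWords q (suc m))) ≡⟨ sum-sig m (indicator ∘ Q?) ⟩
    q * sum (map (indicator ∘ Q?) (allWords q m))           ≡⟨ cong (q *_) (length-filter Q? (allWords q m)) ⟨
    q * count Q? m                                          ∎
    where
      open ≡-Reasoning
      transfer : ∀ u → indicator (P? u) ≡ indicator (Q? (sig u))
      transfer u = indicator-cong (P? u) (Q? (sig u)) (P⇔Q∘sig u)

  count-zero : ∀ {P : Pred (Word q) 0ℓ} (P? : Decidable P) → count P? 0 ≡ indicator (P? [])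
  count-zero P? = trans (length-filter P? (allWords q 0)) (+-identityʳ _)

  count-one : ∀ {P : Pred (Word q) 0ℓ} (P? : Decidable P) c →
              (∀ a → indicator (P? [ a ]) ≡ c) → count P? 1 ≡ q * c
  count-one P? c constant = begin
    count P? 1                                       ≡⟨ length-filter P? (allWords q 1) ⟩
    sum (map (indicator ∘ P?) (allWords q 1))        ≡⟨ sum-allWords-suc 0 _ ⟩
    (∑ λ a → indicator (P? [ a ])) + 0               ≡⟨ +-identityʳ _ ⟩
    (∑ λ a → indicator (P? [ a ]))                   ≡⟨ ∑-cong constant ⟩
    ∑ (λ (_ : Fin q) → c)                                    ≡⟨ ∑-const q c ⟩
    q * c                                            ∎
    where open ≡-Reasoning

-- The counts for a pattern

module _ {q : ℕ} .{{_ : NonZero q}} where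

  private
    orbitFree? : (p : Word q) → Decidable (¬_ ∘ HasOrbitFactor p)
    orbitFree? p u = ¬? (hasOrbitFactor? p u)

  hasOrbitFactor⇒length≤ : ∀ {p u : Word q} → HasOrbitFactor p u → length p ≤ length u
  hasOrbitFactor⇒length≤ {p} (g , i) = subst (_≤ _) (length-map _ p) (length-mono i)

  length<⇒¬hasOrbitFactor : ∀ {p u : Word q} → length u < length p → ¬ HasOrbitFactor p u
  length<⇒¬hasOrbitFactor u<p = <⇒≱ u<p ∘ hasOrbitFactor⇒length≤

  endsOnlyOrbit⇒hasOrbitFactor : ∀ {p u : Word q} → EndsOnlyOrbit p u → HasOrbitFactor p u
  endsOnlyOrbit⇒hasOrbitFactor ((g , s) , _) = g , fromSuffix s

  hasOrbitFactor-singleton : ∀ a x → HasOrbitFactor {q} [ a ] [ x ]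
  hasOrbitFactor-singleton a x = x ⊖ a , here (⊖-⊕ x a ∷ [])

  𝒜-zero : ∀ (p : Word q) → 1 ≤ length p → 𝒜 0 p ≡ 1
  𝒜-zero p 0<∣p∣ = trans (count-zero (orbitFree? p)) (indicator-yes _ (length<⇒¬hasOrbitFactor 0<∣p∣))

  𝒯-zero : ∀ (p : Word q) → 1 ≤ length p → 𝒯 0 p ≡ 0
  𝒯-zero p 0<∣p∣ =
    trans (count-zero (endsOnlyOrbit? p)) (indicator-no _ (length<⇒¬hasOrbitFactor 0<∣p∣ ∘ endsOnlyOrbit⇒hasOrbitFactor))

  𝒜-one : ∀ (p : Word q) → 2 ≤ length p → 𝒜 1 p ≡ q
  𝒜-one p 1<∣p∣ =
    trans (count-one _ 1 λ _ → indicator-yes _ (length<⇒¬hasOrbitFactor 1<∣p∣)) (*-identityʳ q)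

  𝒯-one : ∀ (p : Word q) → 2 ≤ length p → 𝒯 1 p ≡ 0
  𝒯-one p 1<∣p∣ = trans (count-one _ 0 λ _ → indicator-no _ no-orbit-suffix) (*-zeroʳ q)
    where
      no-orbit-suffix : ∀ {x} → ¬ EndsOnlyOrbit p [ x ]
      no-orbit-suffix = length<⇒¬hasOrbitFactor 1<∣p∣ ∘ endsOnlyOrbit⇒hasOrbitFactor

  𝒜-one-singleton : ∀ a → 𝒜 1 [ a ] ≡ 0
  𝒜-one-singleton a =
    trans (count-one _ 0 λ x → indicator-no _ (λ ¬h → ¬h (hasOrbitFactor-singleton a x))) (*-zeroʳ q)

  𝒯-one-singleton : ∀ a → 𝒯 1 [ a ] ≡ q
  𝒯-one-singleton a = trans (count-one _ 1 λ x → indicator-yes _ (ends-only x)) (*-identityʳ q)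
    where
      ends-only : ∀ x → EndsOnlyOrbit [ a ] [ x ]
      ends-only x = (x ⊖ a , here (⊖-⊕ x a Pointwise.∷ Pointwise.[])) , length<⇒¬hasOrbitFactor (s≤s z≤n)

  𝒜-suc : ∀ a b p m → 𝒜 (suc m) (a ∷ b ∷ p) ≡ q * A m (sig (a ∷ b ∷ p))
  𝒜-suc a b p = count-sig _ _ (λ u → ¬-cong-⇔ (hasOrbitFactor⇔factor-sig a b p u))

  𝒯-suc : ∀ a b p m → 𝒯 (suc m) (a ∷ b ∷ p) ≡ q * T m (sig (a ∷ b ∷ p))
  𝒯-suc a b p = count-sig _ _ (endsOnlyOrbit⇔endsOnly-sig a b p)

mainTheorem6 : (q : ℕ) .{{_ : NonZero q}} (p : Word q) → 1 ≤ length p →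
    ((𝒜 0 p ≡ 1) × (𝒯 0 p ≡ 0))
    × ((2 ≤ length p → (𝒜 1 p ≡ q) × (𝒯 1 p ≡ 0))
       × (length p ≡ 1 → (𝒜 1 p ≡ 0) × (𝒯 1 p ≡ q)))
    × ((n : ℕ) → 2 ≤ n → 2 ≤ length p →
         (𝒜 n p ≡ q * A (n ∸ 1) (sig p)) × (𝒯 n p ≡ q * T (n ∸ 1) (sig p)))
mainTheorem6 q p 0<∣p∣ =
    (𝒜-zero p 0<∣p∣ , 𝒯-zero p 0<∣p∣)
  , ((λ 1<∣p∣ → 𝒜-one p 1<∣p∣ , 𝒯-one p 1<∣p∣) , singleton p)
  , λ { (suc m) _ 1<∣p∣ → longer p 1<∣p∣ m }
  where
    singleton : ∀ p → length p ≡ 1 → (𝒜 1 p ≡ 0) × (𝒯 1 p ≡ q)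
    singleton (a ∷ []) _ = 𝒜-one-singleton a , 𝒯-one-singleton a

    longer : ∀ p → 2 ≤ length p → ∀ m → (𝒜 (suc m) p ≡ q * A m (sig p)) × (𝒯 (suc m) p ≡ q * T m (sig p))
    longer (a ∷ b ∷ p)  _         m = 𝒜-suc a b p m , 𝒯-suc a b p m
    longer (_ ∷ [])     (s≤s ())  _
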